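{- Let $n\ge1$, $1\le b\le 2n$, $S=(b)$, and let $l$ be an integer with $l\le 2n-1$ and $l-1\ge2$ even. Put $l'=b-2$ if $b$ is even and $l'=b-1$ if $b$ is odd, and $l''=l-1-l'$; assume $l''\ge0$. Let $T=(1,2,\dots,b-2,\,b,\,b+1,b+2,\dots,b+l'')$ if $b$ is even, and $T=(1,2,\dots,b-1,\,b,\,b+2,b+3,\dots,b+1+l'')$ if $b$ is odd. Then $T\in SST_{2n}((1^l))$ and $\mathrm{red}(T)=(b)$.
   Context: $SST_{2n}((1^l))$ is the set of strictly increasing columns of length $l$ with entries in $\{1,\dots,2n\}$. For a column $\mathbf a=(a_1<\dots<a_l)$: $\mathrm{rem}(\mathbf a)=\emptyset$ if $l\le1$; if $l\ge2$, $a_l$ even, $a_{l-1}=a_l-1$ and $a_l<2l-|\mathrm{rem}(a_1,\dots,a_{l-2})|-1$, then $\mathrm{rem}(\mathbf a)=\mathrm{rem}(a_1,\dots,a_{l-2})\cup\{a_{l-1},a_l\}$; otherwise $\mathrm{rem}(\mathbf a)=\mathrm{rem}(a_1,\dots,a_{l-1})$. $\mathrm{red}(\mathbf a)$ is the column obtained from $\mathbf a$ by deleting the entries of $\mathrm{rem}(\mathbf a)$. -}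

module Defs where

open import Data.Nat using (ℕ; zero; suc; _+_; _*_; _∸_; _≤_; _<_; _%_; _≡ᵇ_; _<ᵇ_)
open import Data.Bool using (Bool; true; false; if_then_else_; _∧_; not)
open import Data.List using (List; []; _∷_; length; reverse; map; upTo; _++_; filter; any)
open import Data.List.Relation.Unary.All using (All)
open import Data.List.Relation.Unary.Linked using (Linked)
open import Data.Product using (_×_)
open import Relation.Binary.PropositionalEquality using (_≡_)
open import Relation.Nullary.Decidable using (¬?)
open import Data.Nat using (_≟_)
open import Data.List.Membership.DecPropositional _≟_ using (_∈?_)

isEven : ℕ → Bool
isEven m = m % 2 ≡ᵇ 0

-- A column (a_1 < ... < a_l) is represented by the list a_1 ∷ ... ∷ a_l ∷ [].
-- SST_{2n}((1^l)): strictly increasing columns of length l, entries in {1,...,2n}.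
SSTcol : ℕ → ℕ → List ℕ → Set
SSTcol n l a = (length a ≡ l) × Linked _<_ a × All (λ x → 1 ≤ x × x ≤ 2 * n) a

-- rem computed on the REVERSED column  a_l ∷ a_{l-1} ∷ ... ∷ a_1.
-- The length l of the current column is the length of the argument list.
-- Condition "a_l < 2l - |rem(a_1..a_{l-2})| - 1" is written (over ℤ-free ℕ)
-- as a_l + |rem| + 1 < 2l, which is equivalent.
remRev : List ℕ → List ℕ
remRev [] = []
remRev (x ∷ []) = []
remRev (x ∷ y ∷ rest) =
  if isEven x ∧ (suc y ≡ᵇ x) ∧ (x + length (remRev rest) + 1 <ᵇ 2 * length (x ∷ y ∷ rest))
  then y ∷ x ∷ remRev rest
  else remRev (y ∷ rest)

remCol : List ℕ → List ℕ
remCol a = remRev (reverse a)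

red : List ℕ → List ℕ
red a = filter (λ x → ¬? (x ∈? remCol a)) a

lPrime : ℕ → ℕ
lPrime b = if isEven b then b ∸ 2 else b ∸ 1

Tcol : ℕ → ℕ → List ℕ
Tcol b l'' =
  if isEven b
  then map suc (upTo (b ∸ 2)) ++ (b ∷ map (λ i → b + suc i) (upTo l''))
  else map suc (upTo (b ∸ 1)) ++ (b ∷ map (λ i → b + 2 + i) (upTo l''))

-- Write k = l′ and r = l″ (both even) and s = k + 2. The column is
-- T = (1, …, k, b, s + 1, …, s + r), where b = k + 1 or b = k + 2, and rem
-- scans it from the top. Reading downwards, the top block s + r, …, s + 1 splits
-- into the pairs (s + 2j, s + 2j − 1), each removed with exactly one unit of slack
-- in the length condition; the same happens for the pairs (2j, 2j − 1) of the
-- bottom block 1, …, k. The entry b is never paired with k: either b = k + 1 is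
-- odd or b − 1 = k + 1 ≠ k. Hence rem(T) consists of all entries except b, and
-- red(T) = (b).
module Submission where

open import Defs
open import Data.Nat using (ℕ; zero; suc; _+_; _*_; _∸_; _≤_; _<_; _%_; _≡ᵇ_; z≤n; z<s; _≟_)
open import Data.Nat.Properties
open import Data.Nat.Tactic.RingSolver using (solve-∀)
open import Data.Bool using (true; false)
open import Data.Bool.Properties using (T-≡)
open import Data.List using (List; []; _∷_; _++_; length; upTo; reverse; filter; applyUpTo; applyDownFrom)
open import Data.List.Properties
  using (length-++; length-applyUpTo; length-applyDownFrom; map-cong; map-upTo; reverse-applyUpTo;
         reverse-++; unfold-reverse; ++-assoc; ++-identityʳ; filter-++; filter-none; filter-accept)
open import Data.List.Relation.Unary.All as All using (All; []; _∷_)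
import Data.List.Relation.Unary.All.Properties as All
open import Data.List.Relation.Unary.Linked using (Linked; []; [-]; _∷_)
import Data.List.Relation.Unary.Linked.Properties as Linked
open import Data.List.Membership.Propositional using (_∈_; _∉_)
open import Data.List.Membership.Propositional.Properties using (∈-++⁺ˡ; ∈-++⁺ʳ)
open import Data.List.Relation.Binary.Permutation.Propositional
  using (_↭_; ↭-refl; ↭-sym; swap; module PermutationReasoning)
import Data.List.Relation.Binary.Permutation.Propositional.Properties as ↭
open import Data.List.Membership.DecPropositional _≟_ using (_∈?_)
open import Data.Product using (_×_; _,_; proj₁; proj₂)
open import Data.Sum using (_⊎_; inj₁; inj₂)
open import Data.Empty using (⊥-elim)
open import Function using (_∘_)
open import Function.Bundles using (Equivalence)
open import Relation.Binary.PropositionalEquality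
open import Relation.Nullary using (¬_)
open import Relation.Nullary.Decidable using (¬?)
open import Relation.Unary using (Decidable)

data Even : ℕ → Set where
  zero    : Even 0
  suc-suc : ∀ {n} → Even n → Even (2 + n)

isEven⇒Even : ∀ n → isEven n ≡ true → Even n
isEven⇒Even 0             _ = zero
isEven⇒Even 1             ()
isEven⇒Even (suc (suc n)) e = suc-suc (isEven⇒Even n e)

isOdd⇒Even-suc : ∀ n → isEven n ≡ false → Even (suc n)
isOdd⇒Even-suc 0             ()
isOdd⇒Even-suc 1             _ = suc-suc zero
isOdd⇒Even-suc (suc (suc n)) e = suc-suc (isOdd⇒Even-suc n e)

Even⇒isEven : ∀ {n} → Even n → isEven n ≡ true
Even⇒isEven zero        = refl
Even⇒isEven (suc-suc e) = Even⇒isEven e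

Even⇒isOdd-suc : ∀ {n} → Even n → isEven (suc n) ≡ false
Even⇒isOdd-suc zero        = refl
Even⇒isOdd-suc (suc-suc e) = Even⇒isOdd-suc e

Even-+ : ∀ {m n} → Even m → Even n → Even (m + n)
Even-+ zero         en = en
Even-+ (suc-suc em) en = suc-suc (Even-+ em en)

Even-∸ : ∀ {m n} → Even m → Even n → Even (m ∸ n)
Even-∸ em           zero         = em
Even-∸ zero         (suc-suc _)  = zero
Even-∸ (suc-suc em) (suc-suc en) = Even-∸ em en

swapPairs : List ℕ → List ℕ
swapPairs []           = []
swapPairs (x ∷ [])     = x ∷ []
swapPairs (x ∷ y ∷ xs) = y ∷ x ∷ swapPairs xs

swapPairs-↭ : ∀ xs → swapPairs xs ↭ xs
swapPairs-↭ []           = ↭-refl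
swapPairs-↭ (x ∷ [])     = ↭-refl
swapPairs-↭ (x ∷ y ∷ xs) = swap y x (swapPairs-↭ xs)

length-swapPairs : ∀ xs → length (swapPairs xs) ≡ length xs
length-swapPairs xs = ↭.↭-length (swapPairs-↭ xs)

filter-∉-deletion : ∀ {Q} xs {y} ys → Q ↭ xs ++ ys → y ∉ xs ++ ys →
  filter (λ z → ¬? (z ∈? Q)) (xs ++ y ∷ ys) ≡ y ∷ []
filter-∉-deletion {Q} xs {y} ys Q↭ y∉ = begin
  filter P? (xs ++ y ∷ ys)            ≡⟨ filter-++ P? xs (y ∷ ys) ⟩
  filter P? xs ++ filter P? (y ∷ ys)  ≡⟨ cong₂ _++_ (filter-none P? {xs} (All.tabulate (in-Q ∘ ∈-++⁺ˡ)))
                                                   (filter-accept P? (y∉ ∘ ↭.∈-resp-↭ Q↭)) ⟩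
  y ∷ filter P? ys                    ≡⟨ cong (y ∷_) (filter-none P? (All.tabulate (in-Q ∘ ∈-++⁺ʳ xs))) ⟩
  y ∷ []                              ∎
  where
  open ≡-Reasoning
  P? : Decidable (λ z → ¬ z ∈ Q)
  P? z = ¬? (z ∈? Q)
  in-Q : ∀ {z} → z ∈ xs ++ ys → ¬ ¬ z ∈ Q
  in-Q z∈ z∉Q = z∉Q (↭.∈-resp-↭ (↭-sym Q↭) z∈)

linked-∷ : ∀ {A : Set} {R : A → A → Set} {x ys} → All (R x) ys → Linked R ys → Linked R (x ∷ ys)
linked-∷ []      []  = [-]
linked-∷ (r ∷ _) rys = r ∷ rys

linked-++-∷ : ∀ {A : Set} {R : A → A → Set} {y ys} xs →
  All (λ x → R x y) xs → Linked R xs → Linked R (y ∷ ys) → Linked R (xs ++ y ∷ ys)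
linked-++-∷ []            _        _         ryys = ryys
linked-++-∷ (x ∷ [])      (r ∷ []) [-]       ryys = r ∷ ryys
linked-++-∷ (x ∷ x′ ∷ xs) (_ ∷ rs) (r ∷ rxs) ryys = r ∷ linked-++-∷ (x′ ∷ xs) rs rxs ryys

remRev-pair : ∀ {x y} R → Even x → suc y ≡ x →
  x + length (remRev R) + 1 < 2 * length (x ∷ y ∷ R) →
  remRev (x ∷ y ∷ R) ≡ y ∷ x ∷ remRev R
remRev-pair {y = y} R ex refl fits
  rewrite Even⇒isEven ex
        | Equivalence.to T-≡ (≡⇒≡ᵇ y y refl)
        | Equivalence.to T-≡ (<⇒<ᵇ fits) = refl

remRev-skip : ∀ {x y} R → isEven x ≡ false ⊎ suc y ≢ x → remRev (x ∷ y ∷ R) ≡ remRev (y ∷ R)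
remRev-skip R (inj₁ odd) rewrite odd = refl
remRev-skip {x} {y} R (inj₂ gap) with isEven x | suc y ≡ᵇ x in pair
... | false | _     = refl
... | true  | false = refl
... | true  | true  = ⊥-elim (gap (≡ᵇ⇒≡ (suc y) x (Equivalence.from T-≡ pair)))

run : ℕ → ℕ → List ℕ
run s = applyUpTo (λ i → s + suc i)

descent : ℕ → ℕ → List ℕ
descent s = applyDownFrom (λ i → s + suc i)

reverse-run : ∀ s r → reverse (run s r) ≡ descent s r
reverse-run s = reverse-applyUpTo (λ i → s + suc i)

length-descent : ∀ s r → length (descent s r) ≡ r
length-descent s = length-applyDownFrom (λ i → s + suc i)

run-increasing : ∀ s r → Linked _<_ (run s r)
run-increasing s r = Linked.applyUpTo⁺₂ _ r (λ i → +-monoʳ-< s (n<1+n (suc i)))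

run-bounds : ∀ s r → All (λ x → s < x × x ≤ s + r) (run s r)
run-bounds s r = All.applyUpTo⁺₁ _ r (λ i<r → m<m+n s z<s , +-monoʳ-≤ s i<r)

run-below : ∀ {b} s r → s + r < b → All (_< b) (run s r)
run-below s r s+r<b = All.map (λ (_ , x≤s+r) → ≤-<-trans x≤s+r s+r<b) (run-bounds s r)

run-above : ∀ {b} s r → b ≤ s → All (b <_) (run s r)
run-above s r b≤s = All.map (λ (s<x , _) → ≤-<-trans b≤s s<x) (run-bounds s r)

pair-fits : ∀ s r q m → s + q ≤ 2 * m → s + suc (suc r) + (r + q) + 1 < 2 * suc (suc (r + m))
pair-fits s r q m room = begin
  suc (s + suc (suc r) + (r + q) + 1) ≡⟨ regroupˡ s r q ⟩
  s + q + (4 + 2 * r)                 ≤⟨ +-monoˡ-≤ (4 + 2 * r) room ⟩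
  2 * m + (4 + 2 * r)                 ≡⟨ regroupʳ r m ⟩
  2 * suc (suc (r + m))               ∎
  where
  open ≤-Reasoning
  regroupˡ : ∀ s r q → suc (s + suc (suc r) + (r + q) + 1) ≡ s + q + (4 + 2 * r)
  regroupˡ = solve-∀
  regroupʳ : ∀ r m → 2 * m + (4 + 2 * r) ≡ 2 * suc (suc (r + m))
  regroupʳ = solve-∀

-- The hypothesis is the length condition of rem for a pair with top entry s + 2
-- lying over R; stacking a pair raises both of its sides by 2, so every pair of
-- the block satisfies it.
remRev-descent : ∀ {s r} R → Even s → Even r → s + length (remRev R) ≤ 2 * length R →
  remRev (descent s r ++ R) ≡ swapPairs (descent s r) ++ remRev R
remRev-descent R es zero room = refl
remRev-descent {s} {suc (suc r)} R es (suc-suc er) room =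
  trans (remRev-pair (descent s r ++ R) (Even-+ es (suc-suc er)) (sym (+-suc s (suc r))) fits)
        (cong (λ rest → s + suc r ∷ s + suc (suc r) ∷ rest) ih)
  where
  ih : remRev (descent s r ++ R) ≡ swapPairs (descent s r) ++ remRev R
  ih = remRev-descent R es er room
  fits : s + suc (suc r) + length (remRev (descent s r ++ R)) + 1
           < 2 * length (s + suc (suc r) ∷ s + suc r ∷ descent s r ++ R)
  fits rewrite ih | length-++ (swapPairs (descent s r)) {remRev R} | length-++ (descent s r) {R}
             | length-swapPairs (descent s r) | length-descent s r = pair-fits s r _ _ room

remRev-descent₀ : ∀ {k} → Even k → remRev (descent 0 k) ≡ swapPairs (descent 0 k)
remRev-descent₀ {k} ek = begin
  remRev (descent 0 k)           ≡⟨ cong remRev (++-identityʳ (descent 0 k)) ⟨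
  remRev (descent 0 k ++ [])     ≡⟨ remRev-descent [] zero ek z≤n ⟩
  swapPairs (descent 0 k) ++ []  ≡⟨ ++-identityʳ (swapPairs (descent 0 k)) ⟩
  swapPairs (descent 0 k)        ∎
  where open ≡-Reasoning

remRev-gap : ∀ {b k} → Even k → b ≡ suc k ⊎ b ≡ 2 + k → remRev (b ∷ descent 0 k) ≡ remRev (descent 0 k)
remRev-gap zero                  _           = refl
remRev-gap ek@(suc-suc {k} _) (inj₁ refl) =
  remRev-skip {3 + k} (descent 0 (suc k)) (inj₁ (Even⇒isOdd-suc ek))
remRev-gap (suc-suc {k} _)    (inj₂ refl) =
  remRev-skip {4 + k} (descent 0 (suc k)) (inj₂ (1+n≢n ∘ sym))

column : ℕ → ℕ → ℕ → List ℕ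
column k b r = run 0 k ++ b ∷ run (2 + k) r

length-column : ∀ k b r → length (column k b r) ≡ suc (k + r)
length-column k b r = begin
  length (run 0 k ++ b ∷ run (2 + k) r)            ≡⟨ length-++ (run 0 k) ⟩
  length (run 0 k) + suc (length (run (2 + k) r))
    ≡⟨ cong₂ (λ m n → m + suc n) (length-applyUpTo _ k) (length-applyUpTo _ r) ⟩
  k + suc r                                        ≡⟨ +-suc k r ⟩
  suc (k + r)                                      ∎
  where open ≡-Reasoning

reverse-column : ∀ k b r → reverse (column k b r) ≡ descent (2 + k) r ++ b ∷ descent 0 k
reverse-column k b r = begin
  reverse (run 0 k ++ b ∷ run (2 + k) r)
    ≡⟨ reverse-++ (run 0 k) (b ∷ run (2 + k) r) ⟩
  reverse (b ∷ run (2 + k) r) ++ reverse (run 0 k)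
    ≡⟨ cong (_++ reverse (run 0 k)) (unfold-reverse b (run (2 + k) r)) ⟩
  (reverse (run (2 + k) r) ++ b ∷ []) ++ reverse (run 0 k)
    ≡⟨ ++-assoc (reverse (run (2 + k) r)) (b ∷ []) (reverse (run 0 k)) ⟩
  reverse (run (2 + k) r) ++ b ∷ reverse (run 0 k)
    ≡⟨ cong₂ (λ xs ys → xs ++ b ∷ ys) (reverse-run (2 + k) r) (reverse-run 0 k) ⟩
  descent (2 + k) r ++ b ∷ descent 0 k
    ∎
  where open ≡-Reasoning

remCol-column : ∀ {k b r} → Even k → Even r → b ≡ suc k ⊎ b ≡ 2 + k →
  remCol (column k b r) ↭ run 0 k ++ run (2 + k) r
remCol-column {k} {b} {r} ek er shape = begin
  remRev (reverse (column k b r))                ≡⟨ cong remRev (reverse-column k b r) ⟩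
  remRev (descent (2 + k) r ++ b ∷ descent 0 k)  ≡⟨ remRev-descent (b ∷ descent 0 k) (suc-suc ek) er room ⟩
  swapPairs (descent (2 + k) r) ++ remRev (b ∷ descent 0 k)
    ≡⟨ cong (swapPairs (descent (2 + k) r) ++_) below ⟩
  swapPairs (descent (2 + k) r) ++ swapPairs (descent 0 k)
    ↭⟨ ↭.++⁺ (swapPairs-↭ (descent (2 + k) r)) (swapPairs-↭ (descent 0 k)) ⟩
  descent (2 + k) r ++ descent 0 k               ↭⟨ ↭.++-comm (descent (2 + k) r) (descent 0 k) ⟩
  descent 0 k ++ descent (2 + k) r               ≡⟨ cong₂ _++_ (reverse-run 0 k) (reverse-run (2 + k) r) ⟨
  reverse (run 0 k) ++ reverse (run (2 + k) r)   ↭⟨ ↭.++⁺ (↭.↭-reverse (run 0 k)) (↭.↭-reverse (run (2 + k) r)) ⟩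
  run 0 k ++ run (2 + k) r                       ∎
  where
  open PermutationReasoning
  below : remRev (b ∷ descent 0 k) ≡ swapPairs (descent 0 k)
  below = trans (remRev-gap ek shape) (remRev-descent₀ ek)
  double : ∀ k → 2 + k + k ≡ 2 * suc k
  double = solve-∀
  room : 2 + k + length (remRev (b ∷ descent 0 k)) ≤ 2 * length (b ∷ descent 0 k)
  room rewrite below | length-swapPairs (descent 0 k) | length-descent 0 k = ≤-reflexive (double k)

column-increasing : ∀ {k b} r → k < b → b ≤ 2 + k → Linked _<_ (column k b r)
column-increasing {k} r k<b b≤2+k =
  linked-++-∷ (run 0 k) (run-below 0 k k<b) (run-increasing 0 k)
    (linked-∷ (run-above (2 + k) r b≤2+k) (run-increasing (2 + k) r))

column-SST : ∀ {n k b} r → k < b → b ≤ 2 + k → 2 + k + r ≤ 2 * n → SSTcol n (suc (k + r)) (column k b r)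
column-SST {n} {k} {b} r k<b b≤2+k top≤2n =
  length-column k b r , column-increasing r k<b b≤2+k ,
  All.++⁺ (All.map (λ (0<x , x≤k) → 0<x , ≤2n (≤-trans x≤k (m≤n+m k 2))) (run-bounds 0 k))
          ((≤-trans z<s k<b , ≤2n b≤2+k) ∷
           All.map (λ (s<x , x≤s+r) → ≤-trans z<s s<x , ≤-trans x≤s+r top≤2n) (run-bounds (2 + k) r))
  where
  ≤2n : ∀ {x} → x ≤ 2 + k → x ≤ 2 * n
  ≤2n x≤2+k = ≤-trans (≤-trans x≤2+k (m≤m+n (2 + k) r)) top≤2n

∉-column-rest : ∀ {k b} r → k < b → b ≤ 2 + k → b ∉ run 0 k ++ run (2 + k) r
∉-column-rest {k} r k<b b≤2+k =
  All.All¬⇒¬Any (All.++⁺ (All.map >⇒≢ (run-below 0 k k<b)) (All.map <⇒≢ (run-above (2 + k) r b≤2+k)))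

shape-bounds : ∀ {k b} → b ≡ suc k ⊎ b ≡ 2 + k → k < b × b ≤ 2 + k
shape-bounds (inj₁ refl) = ≤-refl , n≤1+n _
shape-bounds (inj₂ refl) = n≤1+n _ , ≤-refl

red-column : ∀ {k b r} → Even k → Even r → b ≡ suc k ⊎ b ≡ 2 + k → red (column k b r) ≡ b ∷ []
red-column {k} {b} {r} ek er shape =
  filter-∉-deletion (run 0 k) (run (2 + k) r) (remCol-column ek er shape)
    (∉-column-rest r (proj₁ (shape-bounds shape)) (proj₂ (shape-bounds shape)))

lPrime-even : ∀ b → Even (lPrime b)
lPrime-even 0 = zero
lPrime-even 1 = zero
lPrime-even (suc (suc b)) with isEven b in parity
... | true  = isEven⇒Even b parity
... | false = isOdd⇒Even-suc b parity

lPrime-shape : ∀ {b} → 1 ≤ b → b ≡ suc (lPrime b) ⊎ b ≡ 2 + lPrime b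
lPrime-shape {1}           _ = inj₁ refl
lPrime-shape {suc (suc b)} _ with isEven b
... | true  = inj₂ refl
... | false = inj₁ refl

Tcol≡column : ∀ {b} → 1 ≤ b → ∀ r → Tcol b r ≡ column (lPrime b) b r
Tcol≡column {1}           _ r = cong (1 ∷_) (map-upTo _ r)
Tcol≡column {suc (suc b)} _ r with isEven b
... | true  = cong₂ (λ xs ys → xs ++ suc (suc b) ∷ ys) (map-upTo suc b) (map-upTo _ r)
... | false = cong₂ (λ xs ys → xs ++ suc (suc b) ∷ ys) (map-upTo suc (suc b))
                (trans (map-cong shift (upTo r)) (map-upTo _ r))
  where
  shift : ∀ i → suc (suc b) + 2 + i ≡ 2 + suc b + suc i
  shift i = cong (2 +_) (trans (+-assoc b 2 i) (+-suc b (suc i)))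

mainTheorem7 : (n b l : ℕ) → 1 ≤ n → 1 ≤ b → b ≤ 2 * n →
    l ≤ 2 * n ∸ 1 → 2 ≤ l ∸ 1 → (l ∸ 1) % 2 ≡ 0 →
    lPrime b ≤ l ∸ 1 →
    SSTcol n l (Tcol b (l ∸ 1 ∸ lPrime b)) ×
      red (Tcol b (l ∸ 1 ∸ lPrime b)) ≡ b ∷ []
mainTheorem7 n b zero _ _ _ _ () _ _
mainTheorem7 n b (suc l′) _ 1≤b b≤2n l≤2n∸1 _ l′%2≡0 k≤l′
  rewrite Tcol≡column 1≤b (l′ ∸ lPrime b) =
  subst (λ m → SSTcol n (suc m) (column k b r)) k+r≡l′ (column-SST {n} r k<b b≤2+k top≤2n) ,
  red-column (lPrime-even b) (Even-∸ (isEven⇒Even l′ (cong (_≡ᵇ 0) l′%2≡0)) (lPrime-even b)) shape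
  where
  k r : ℕ
  k = lPrime b
  r = l′ ∸ k
  shape : b ≡ suc k ⊎ b ≡ 2 + k
  shape = lPrime-shape 1≤b
  k<b : k < b
  k<b = proj₁ (shape-bounds shape)
  b≤2+k : b ≤ 2 + k
  b≤2+k = proj₂ (shape-bounds shape)
  k+r≡l′ : k + r ≡ l′
  k+r≡l′ = m+[n∸m]≡n k≤l′
  top≤2n : 2 + k + r ≤ 2 * n
  top≤2n = begin
    2 + (k + r)  ≡⟨ cong (2 +_) k+r≡l′ ⟩
    2 + l′       ≡⟨ +-comm 1 (suc l′) ⟩
    suc l′ + 1   ≤⟨ m≤o∸n⇒m+n≤o (suc l′) (≤-trans 1≤b b≤2n) l≤2n∸1 ⟩
    2 * n        ∎
    where open ≤-Reasoning
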